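{- For any positive even integer $n$, \[\sum_{k=0}^{n-1}\binom{n-1}k\binom{n+k}{2k}\binom{2k}{k+1}\equiv1\pmod2.\] -}

module Defs where

open import Data.Nat using (ℕ; zero; suc; _+_; _*_; _∸_)
open import Data.Nat.Combinatorics using (_C_)
open import Data.List using (map; upTo)
open import Data.Nat.ListAction using (sum)

term : ℕ → ℕ → ℕ
term n k = ((n ∸ 1) C k) * ((n + k) C (2 * k)) * ((2 * k) C (k + 1))

S : ℕ → ℕ
S n = sum (map (term n) (upTo n))

{-# OPTIONS --safe #-}
module Submission where

open import Defs
open import Data.List using (map; upTo; _++_; [_])
open import Data.List.Properties using (map-++; upTo-∷ʳ)
open import Data.Nat using (ℕ; zero; suc; _+_; _*_; _∸_; _<_; _%_; s≤s; parity)
open import Data.Nat.Combinatorics using (_C_; nCk+nC[k+1]≡[n+1]C[k+1]; nCk≡nC[n∸k]; nC1≡n)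
open import Data.Nat.Divisibility using (_∣_; divides)
open import Data.Nat.Induction using (<-wellFounded)
open import Data.Nat.ListAction using (sum)
open import Data.Nat.ListAction.Properties using (sum-++)
open import Data.Nat.Properties using (+-suc; +-comm; +-assoc; +-identityʳ; *-identityˡ; *-identityʳ; *-comm; m+n∸n≡m; m≤n+m; m≤m+n)
open import Data.Nat.Tactic.RingSolver using (solve-∀)
open import Data.Parity.Base using (0ℙ; 1ℙ)
import Data.Parity.Base as ℙ
open import Data.Parity.Properties using (+-homo-+; *-homo-*; p+p≡0ℙ)
import Data.Parity.Properties as ℙₚ
open import Function using (_∘_)
open import Induction.WellFounded using (Acc; acc)
open import Relation.Binary.PropositionalEquality
  using (_≡_; refl; sym; trans; cong; cong₂; subst; module ≡-Reasoning)
open ≡-Reasoning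

-- Only parities matter, and Lucas's theorem at the prime 2 computes them. For n = 2m the
-- summands with even k vanish (their last factor is C(4i, 2i+1): even top, odd bottom),
-- and the summand with k = 2j+1 has the parity of
--   h(m, j) = C(m-1, j) C(m+j, 2j+1) C(2j+1, j+1)   (halfTerm m j below).
-- This family is self-similar: in the sum of h(2m, j) over j < 2m the even-index terms
-- vanish again (h(2m, 0) = 2m, and for j = 2i+2 the last factor has the parity of the
-- central binomial coefficient C(2i+2, i+1), which is even), while h(2m, 2j+1) ≡ h(m, j).
-- For odd m only h(m, 0) = m survives. So by strong induction on m the sum of h(m, j)
-- over j < m is odd for every m ≥ 1, and hence so is the sum in the theorem.

parity-double : ∀ m → parity (m + m) ≡ 0ℙ
parity-double m = trans (+-homo-+ m m) (p+p≡0ℙ (parity m))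

parity-suc-double : ∀ m → parity (suc (m + m)) ≡ 1ℙ
parity-suc-double m = trans (+-homo-+ 1 (m + m)) (cong ℙ._⁻¹ (parity-double m))

parity≡1ℙ⇒%2≡1 : ∀ n → parity n ≡ 1ℙ → n % 2 ≡ 1
parity≡1ℙ⇒%2≡1 zero          ()
parity≡1ℙ⇒%2≡1 (suc zero)    _ = refl
parity≡1ℙ⇒%2≡1 (suc (suc n)) p = parity≡1ℙ⇒%2≡1 n p

parity-*³ : ∀ x y z → parity (x * y * z) ≡ parity x ℙ.* parity y ℙ.* parity z
parity-*³ x y z = trans (*-homo-* (x * y) z) (cong (ℙ._* parity z) (*-homo-* x y))

double-suc : ∀ a → suc a + suc a ≡ suc (suc (a + a))
double-suc a = cong suc (+-suc a a)

2*m≡m+m : ∀ m → 2 * m ≡ m + m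
2*m≡m+m = solve-∀

data EvenOdd : ℕ → Set where
  even : ∀ r → EvenOdd (r + r)
  odd  : ∀ r → EvenOdd (suc (r + r))

evenOdd : ∀ n → EvenOdd n
evenOdd zero = even 0
evenOdd (suc n) with evenOdd n
... | even r = odd r
... | odd r  = subst EvenOdd (cong suc (+-suc r r)) (even (suc r))

parity-pascal : ∀ n k → parity (suc n C suc k) ≡ parity (n C k) ℙ.+ parity (n C suc k)
parity-pascal n k =
  trans (cong parity (sym (nCk+nC[k+1]≡[n+1]C[k+1] n k))) (+-homo-+ (n C k) (n C suc k))

-- Lucas's theorem mod 2, one binary digit at a time: C(2a+i, 2b+j) ≡ C(a, b) C(i, j).
mutual
  parity-C-even-even : ∀ a b → parity ((a + a) C (b + b)) ≡ parity (a C b)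
  parity-C-even-even zero    zero    = refl
  parity-C-even-even zero    (suc b) = refl
  parity-C-even-even (suc a) zero    = refl
  parity-C-even-even (suc a) (suc b) = begin
    parity ((suc a + suc a) C (suc b + suc b))
      ≡⟨ cong parity (cong₂ _C_ (double-suc a) (double-suc b)) ⟩
    parity (suc (suc (a + a)) C suc (suc (b + b)))
      ≡⟨ parity-pascal (suc (a + a)) (suc (b + b)) ⟩
    parity (suc (a + a) C suc (b + b)) ℙ.+ parity (suc (a + a) C suc (suc (b + b)))
      ≡⟨ cong₂ ℙ._+_ (parity-C-odd-odd a b)
                     (trans (cong (λ k → parity (suc (a + a) C k)) (sym (double-suc b)))
                            (parity-C-odd-even a (suc b))) ⟩
    parity (a C b) ℙ.+ parity (a C suc b)
      ≡⟨ parity-pascal a b ⟨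
    parity (suc a C suc b) ∎

  parity-C-even-odd : ∀ a b → parity ((a + a) C suc (b + b)) ≡ 0ℙ
  parity-C-even-odd zero    b = refl
  parity-C-even-odd (suc a) b = begin
    parity ((suc a + suc a) C suc (b + b))
      ≡⟨ cong (λ n → parity (n C suc (b + b))) (double-suc a) ⟩
    parity (suc (suc (a + a)) C suc (b + b))
      ≡⟨ parity-pascal (suc (a + a)) (b + b) ⟩
    parity (suc (a + a) C (b + b)) ℙ.+ parity (suc (a + a) C suc (b + b))
      ≡⟨ cong₂ ℙ._+_ (parity-C-odd-even a b) (parity-C-odd-odd a b) ⟩
    parity (a C b) ℙ.+ parity (a C b)
      ≡⟨ p+p≡0ℙ (parity (a C b)) ⟩
    0ℙ ∎

  parity-C-odd-even : ∀ a b → parity (suc (a + a) C (b + b)) ≡ parity (a C b)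
  parity-C-odd-even a zero    = refl
  parity-C-odd-even a (suc b) = begin
    parity (suc (a + a) C (suc b + suc b))
      ≡⟨ cong (λ k → parity (suc (a + a) C k)) (double-suc b) ⟩
    parity (suc (a + a) C suc (suc (b + b)))
      ≡⟨ parity-pascal (a + a) (suc (b + b)) ⟩
    parity ((a + a) C suc (b + b)) ℙ.+ parity ((a + a) C suc (suc (b + b)))
      ≡⟨ cong₂ ℙ._+_ (parity-C-even-odd a b)
                     (trans (cong (λ k → parity ((a + a) C k)) (sym (double-suc b)))
                            (parity-C-even-even a (suc b))) ⟩
    parity (a C suc b) ∎

  parity-C-odd-odd : ∀ a b → parity (suc (a + a) C suc (b + b)) ≡ parity (a C b)
  parity-C-odd-odd a b = begin
    parity (suc (a + a) C suc (b + b))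
      ≡⟨ parity-pascal (a + a) (b + b) ⟩
    parity ((a + a) C (b + b)) ℙ.+ parity ((a + a) C suc (b + b))
      ≡⟨ cong₂ ℙ._+_ (parity-C-even-even a b) (parity-C-even-odd a b) ⟩
    parity (a C b) ℙ.+ 0ℙ
      ≡⟨ ℙₚ.+-identityʳ (parity (a C b)) ⟩
    parity (a C b) ∎

[2m+2]C[m+1]≡[2m+1]Cm+[2m+1]Cm : ∀ m → (suc m + suc m) C suc m ≡ (m + suc m) C m + (m + suc m) C m
[2m+2]C[m+1]≡[2m+1]Cm+[2m+1]Cm m = begin
  suc N C suc m        ≡⟨ nCk+nC[k+1]≡[n+1]C[k+1] N m ⟨
  N C m + N C suc m    ≡⟨ cong (N C m +_) (nCk≡nC[n∸k] (m≤n+m (suc m) m)) ⟩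
  N C m + N C (N ∸ suc m) ≡⟨ cong (λ k → N C m + N C k) (m+n∸n≡m m (suc m)) ⟩
  N C m + N C m        ∎
  where N = m + suc m

parity-central-binomial : ∀ m → parity ((suc m + suc m) C suc m) ≡ 0ℙ
parity-central-binomial m =
  trans (cong parity ([2m+2]C[m+1]≡[2m+1]Cm+[2m+1]Cm m)) (parity-double ((m + suc m) C m))

sumBelow : ℕ → (ℕ → ℕ) → ℕ
sumBelow n f = sum (map f (upTo n))

sumBelow-suc : ∀ n f → sumBelow (suc n) f ≡ sumBelow n f + f n
sumBelow-suc n f = begin
  sum (map f (upTo (suc n)))           ≡⟨ cong (sum ∘ map f) (upTo-∷ʳ n) ⟨
  sum (map f (upTo n ++ [ n ]))        ≡⟨ cong sum (map-++ f (upTo n) [ n ]) ⟩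
  sum (map f (upTo n) ++ [ f n ])      ≡⟨ sum-++ (map f (upTo n)) [ f n ] ⟩
  sumBelow n f + (f n + 0)             ≡⟨ cong (sumBelow n f +_) (+-identityʳ (f n)) ⟩
  sumBelow n f + f n                   ∎

sumBelow-double : ∀ L f → sumBelow (L + L) f ≡ sumBelow L (λ j → f (j + j) + f (suc (j + j)))
sumBelow-double zero    f = refl
sumBelow-double (suc L) f = begin
  sumBelow (suc L + suc L) f
    ≡⟨ cong (λ n → sumBelow n f) (double-suc L) ⟩
  sumBelow (suc (suc (L + L))) f
    ≡⟨ sumBelow-suc (suc (L + L)) f ⟩
  sumBelow (suc (L + L)) f + f (suc (L + L))
    ≡⟨ cong (_+ f (suc (L + L))) (sumBelow-suc (L + L) f) ⟩
  sumBelow (L + L) f + f (L + L) + f (suc (L + L))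
    ≡⟨ +-assoc (sumBelow (L + L) f) _ _ ⟩
  sumBelow (L + L) f + (f (L + L) + f (suc (L + L)))
    ≡⟨ cong (_+ (f (L + L) + f (suc (L + L)))) (sumBelow-double L f) ⟩
  sumBelow L g + g L
    ≡⟨ sumBelow-suc L g ⟨
  sumBelow (suc L) g ∎
  where g = λ j → f (j + j) + f (suc (j + j))

parity-sumBelow-cong : ∀ n {f g} → (∀ k → parity (f k) ≡ parity (g k)) →
                       parity (sumBelow n f) ≡ parity (sumBelow n g)
parity-sumBelow-cong zero    eq = refl
parity-sumBelow-cong (suc n) {f} {g} eq = begin
  parity (sumBelow (suc n) f)                  ≡⟨ cong parity (sumBelow-suc n f) ⟩
  parity (sumBelow n f + f n)                  ≡⟨ +-homo-+ (sumBelow n f) (f n) ⟩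
  parity (sumBelow n f) ℙ.+ parity (f n)       ≡⟨ cong₂ ℙ._+_ (parity-sumBelow-cong n eq) (eq n) ⟩
  parity (sumBelow n g) ℙ.+ parity (g n)       ≡⟨ +-homo-+ (sumBelow n g) (g n) ⟨
  parity (sumBelow n g + g n)                  ≡⟨ cong parity (sumBelow-suc n g) ⟨
  parity (sumBelow (suc n) g)                  ∎

parity-sumBelow-odd-indices : ∀ L f → (∀ j → parity (f (j + j)) ≡ 0ℙ) →
  parity (sumBelow (L + L) f) ≡ parity (sumBelow L (λ j → f (suc (j + j))))
parity-sumBelow-odd-indices L f even-vanishes = trans
  (cong parity (sumBelow-double L f))
  (parity-sumBelow-cong L λ j →
    trans (+-homo-+ (f (j + j)) (f (suc (j + j))))
          (cong (ℙ._+ parity (f (suc (j + j)))) (even-vanishes j)))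

parity-sumBelow-head : ∀ n f → (∀ k → parity (f (suc k)) ≡ 0ℙ) →
  parity (sumBelow (suc n) f) ≡ parity (f 0)
parity-sumBelow-head zero    f tail-vanishes = cong parity (+-identityʳ (f 0))
parity-sumBelow-head (suc n) f tail-vanishes = begin
  parity (sumBelow (suc (suc n)) f)                   ≡⟨ cong parity (sumBelow-suc (suc n) f) ⟩
  parity (sumBelow (suc n) f + f (suc n))             ≡⟨ +-homo-+ (sumBelow (suc n) f) (f (suc n)) ⟩
  parity (sumBelow (suc n) f) ℙ.+ parity (f (suc n))
    ≡⟨ cong₂ ℙ._+_ (parity-sumBelow-head n f tail-vanishes) (tail-vanishes n) ⟩
  parity (f 0) ℙ.+ 0ℙ                                 ≡⟨ ℙₚ.+-identityʳ (parity (f 0)) ⟩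
  parity (f 0)                                        ∎

halfTerm : ℕ → ℕ → ℕ
halfTerm m j = ((m ∸ 1) C j) * ((m + j) C suc (j + j)) * (suc (j + j) C suc j)

halfTerm-zero : ∀ m → halfTerm m 0 ≡ m
halfTerm-zero m = begin
  1 * ((m + 0) C 1) * 1  ≡⟨ *-identityʳ (1 * ((m + 0) C 1)) ⟩
  1 * ((m + 0) C 1)      ≡⟨ *-identityˡ ((m + 0) C 1) ⟩
  (m + 0) C 1            ≡⟨ cong (_C 1) (+-identityʳ m) ⟩
  m C 1                  ≡⟨ nC1≡n m ⟩
  m                      ∎

parity-halfTerm-even-suc : ∀ m i → parity (halfTerm m (suc i + suc i)) ≡ 0ℙ
parity-halfTerm-even-suc m i = begin
  parity (halfTerm m j)
    ≡⟨ parity-*³ ((m ∸ 1) C j) ((m + j) C suc (j + j)) (suc (j + j) C suc j) ⟩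
  parity ((m ∸ 1) C j) ℙ.* parity ((m + j) C suc (j + j)) ℙ.* parity (suc (j + j) C suc j)
    ≡⟨ cong (parity ((m ∸ 1) C j) ℙ.* parity ((m + j) C suc (j + j)) ℙ.*_)
            (trans (parity-C-odd-odd j (suc i)) (parity-central-binomial i)) ⟩
  parity ((m ∸ 1) C j) ℙ.* parity ((m + j) C suc (j + j)) ℙ.* 0ℙ
    ≡⟨ ℙₚ.*-zeroʳ _ ⟩
  0ℙ ∎
  where j = suc i + suc i

parity-halfTerm-even-even : ∀ m j → parity (halfTerm (m + m) (j + j)) ≡ 0ℙ
parity-halfTerm-even-even m zero    = trans (cong parity (halfTerm-zero (m + m))) (parity-double m)
parity-halfTerm-even-even m (suc i) = parity-halfTerm-even-suc (m + m) i

parity-halfTerm-odd-odd : ∀ r i → parity (halfTerm (suc (r + r)) (suc (i + i))) ≡ 0ℙ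
parity-halfTerm-odd-odd r i = begin
  parity (halfTerm m j)
    ≡⟨ parity-*³ ((m ∸ 1) C j) ((m + j) C suc (j + j)) (suc (j + j) C suc j) ⟩
  parity ((m ∸ 1) C j) ℙ.* parity ((m + j) C suc (j + j)) ℙ.* parity (suc (j + j) C suc j)
    ≡⟨ cong (λ x → parity ((m ∸ 1) C j) ℙ.* x ℙ.* parity (suc (j + j) C suc j))
            (trans (cong (λ n → parity (n C suc (j + j))) (m+j≡double r i))
                   (parity-C-even-odd (suc r + i) j)) ⟩
  parity ((m ∸ 1) C j) ℙ.* 0ℙ ℙ.* parity (suc (j + j) C suc j)
    ≡⟨ cong (ℙ._* parity (suc (j + j) C suc j)) (ℙₚ.*-zeroʳ (parity ((m ∸ 1) C j))) ⟩
  0ℙ ∎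
  where
  m = suc (r + r)
  j = suc (i + i)
  m+j≡double : ∀ r i → suc (r + r) + suc (i + i) ≡ (suc r + i) + (suc r + i)
  m+j≡double = solve-∀

parity-halfTerm-odd-suc : ∀ r k → parity (halfTerm (suc (r + r)) (suc k)) ≡ 0ℙ
parity-halfTerm-odd-suc r k with evenOdd k
... | even i = parity-halfTerm-odd-odd r i
... | odd i  = trans (cong (parity ∘ halfTerm (suc (r + r))) (sym (double-suc i)))
                     (parity-halfTerm-even-suc (suc (r + r)) i)

parity-halfTerm-double : ∀ r i →
  parity (halfTerm (suc r + suc r) (suc (i + i))) ≡ parity (halfTerm (suc r) i)
parity-halfTerm-double r i = begin
  parity (halfTerm m j)
    ≡⟨ parity-*³ ((m ∸ 1) C j) ((m + j) C suc (j + j)) (suc (j + j) C suc j) ⟩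
  parity ((m ∸ 1) C j) ℙ.* parity ((m + j) C suc (j + j)) ℙ.* parity (suc (j + j) C suc j)
    ≡⟨ cong₂ ℙ._*_ (cong₂ ℙ._*_ first second) third ⟩
  parity (r C i) ℙ.* parity ((suc r + i) C suc (i + i)) ℙ.* parity (suc (i + i) C suc i)
    ≡⟨ parity-*³ (r C i) ((suc r + i) C suc (i + i)) (suc (i + i) C suc i) ⟨
  parity (halfTerm (suc r) i) ∎
  where
  m = suc r + suc r
  j = suc (i + i)
  m+j≡suc-double : ∀ r i → (suc r + suc r) + suc (i + i) ≡ suc ((suc r + i) + (suc r + i))
  m+j≡suc-double = solve-∀
  first : parity ((m ∸ 1) C j) ≡ parity (r C i)
  first = trans (cong (λ n → parity (n C j)) (+-suc r r)) (parity-C-odd-odd r i)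
  second : parity ((m + j) C suc (j + j)) ≡ parity ((suc r + i) C suc (i + i))
  second = trans (cong (λ n → parity (n C suc (j + j))) (m+j≡suc-double r i))
                 (parity-C-odd-odd (suc r + i) j)
  third : parity (suc (j + j) C suc j) ≡ parity (suc (i + i) C suc i)
  third = trans (cong (λ k → parity (suc (j + j) C k)) (sym (double-suc i)))
                (parity-C-odd-even j (suc i))

parity-halfSum : ∀ m → parity (sumBelow (suc m) (halfTerm (suc m))) ≡ 1ℙ
parity-halfSum m = go m (<-wellFounded m)
  where
  go : ∀ m → Acc _<_ m → parity (sumBelow (suc m) (halfTerm (suc m))) ≡ 1ℙ
  go m _ with evenOdd m
  ... | even r = begin
    parity (sumBelow (suc (r + r)) (halfTerm (suc (r + r))))
      ≡⟨ parity-sumBelow-head (r + r) (halfTerm (suc (r + r))) (parity-halfTerm-odd-suc r) ⟩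
    parity (halfTerm (suc (r + r)) 0)
      ≡⟨ cong parity (halfTerm-zero (suc (r + r))) ⟩
    parity (suc (r + r))
      ≡⟨ parity-suc-double r ⟩
    1ℙ ∎
  go .(suc (r + r)) (acc rs) | odd r = begin
    parity (sumBelow (suc (suc (r + r))) (halfTerm (suc (suc (r + r)))))
      ≡⟨ cong (λ n → parity (sumBelow n (halfTerm n))) (double-suc r) ⟨
    parity (sumBelow (suc r + suc r) (halfTerm (suc r + suc r)))
      ≡⟨ parity-sumBelow-odd-indices (suc r) (halfTerm (suc r + suc r))
                                     (parity-halfTerm-even-even (suc r)) ⟩
    parity (sumBelow (suc r) (λ j → halfTerm (suc r + suc r) (suc (j + j))))
      ≡⟨ parity-sumBelow-cong (suc r) {λ j → halfTerm (suc r + suc r) (suc (j + j))}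
                                      {halfTerm (suc r)} (parity-halfTerm-double r) ⟩
    parity (sumBelow (suc r) (halfTerm (suc r)))
      ≡⟨ go r (rs (s≤s (m≤m+n r r))) ⟩
    1ℙ ∎

parity-term-even-index : ∀ n j → parity (term n (j + j)) ≡ 0ℙ
parity-term-even-index n j = begin
  parity (term n k)
    ≡⟨ parity-*³ ((n ∸ 1) C k) ((n + k) C (2 * k)) ((2 * k) C (k + 1)) ⟩
  parity ((n ∸ 1) C k) ℙ.* parity ((n + k) C (2 * k)) ℙ.* parity ((2 * k) C (k + 1))
    ≡⟨ cong (parity ((n ∸ 1) C k) ℙ.* parity ((n + k) C (2 * k)) ℙ.*_)
            (trans (cong parity (cong₂ _C_ (2*m≡m+m k) (+-comm k 1))) (parity-C-even-odd k j)) ⟩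
  parity ((n ∸ 1) C k) ℙ.* parity ((n + k) C (2 * k)) ℙ.* 0ℙ
    ≡⟨ ℙₚ.*-zeroʳ _ ⟩
  0ℙ ∎
  where k = j + j

parity-term-odd-index : ∀ p j →
  parity (term (suc p + suc p) (suc (j + j))) ≡ parity (halfTerm (suc p) j)
parity-term-odd-index p j = begin
  parity (term n k)
    ≡⟨ parity-*³ ((n ∸ 1) C k) ((n + k) C (2 * k)) ((2 * k) C (k + 1)) ⟩
  parity ((n ∸ 1) C k) ℙ.* parity ((n + k) C (2 * k)) ℙ.* parity ((2 * k) C (k + 1))
    ≡⟨ cong₂ ℙ._*_ (cong₂ ℙ._*_ first second) third ⟩
  parity (p C j) ℙ.* parity ((suc p + j) C suc (j + j)) ℙ.* parity (suc (j + j) C suc j)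
    ≡⟨ parity-*³ (p C j) ((suc p + j) C suc (j + j)) (suc (j + j) C suc j) ⟨
  parity (halfTerm (suc p) j) ∎
  where
  n = suc p + suc p
  k = suc (j + j)
  n+k≡suc-double : ∀ p j → (suc p + suc p) + suc (j + j) ≡ suc ((suc p + j) + (suc p + j))
  n+k≡suc-double = solve-∀
  k+1≡double : ∀ j → suc (j + j) + 1 ≡ suc j + suc j
  k+1≡double = solve-∀
  first : parity ((n ∸ 1) C k) ≡ parity (p C j)
  first = trans (cong (λ m → parity (m C k)) (+-suc p p)) (parity-C-odd-odd p j)
  second : parity ((n + k) C (2 * k)) ≡ parity ((suc p + j) C suc (j + j))
  second = trans (cong parity (cong₂ _C_ (n+k≡suc-double p j) (2*m≡m+m k)))
                 (parity-C-odd-even (suc p + j) k)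
  third : parity ((2 * k) C (k + 1)) ≡ parity (suc (j + j) C suc j)
  third = trans (cong parity (cong₂ _C_ (2*m≡m+m k) (k+1≡double j)))
                (parity-C-even-even k (suc j))

parity-S-double : ∀ p → parity (S (suc p + suc p)) ≡ 1ℙ
parity-S-double p = begin
  parity (sumBelow (m + m) (term (m + m)))
    ≡⟨ parity-sumBelow-odd-indices m (term (m + m)) (parity-term-even-index (m + m)) ⟩
  parity (sumBelow m (λ j → term (m + m) (suc (j + j))))
    ≡⟨ parity-sumBelow-cong m {λ j → term (m + m) (suc (j + j))} {halfTerm m}
                              (parity-term-odd-index p) ⟩
  parity (sumBelow m (halfTerm m))
    ≡⟨ parity-halfSum p ⟩
  1ℙ ∎
  where m = suc p

lemma2p2 : (n : ℕ) → 0 < n → 2 ∣ n → S n % 2 ≡ 1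
lemma2p2 .0             () (divides zero refl)
lemma2p2 .(suc p * 2) _  (divides (suc p) refl) =
  parity≡1ℙ⇒%2≡1 (S (suc p * 2))
    (subst (λ n → parity (S n) ≡ 1ℙ) (sym n*2≡n+n) (parity-S-double p))
  where
  n*2≡n+n : suc p * 2 ≡ suc p + suc p
  n*2≡n+n = trans (*-comm (suc p) 2) (2*m≡m+m (suc p))
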